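{- Let $k\geq1$, let $G_i=(V_i,E_i)$ ($1\le i\le k$) and $H=(V_H,E_H)$ be pairwise vertex-disjoint, connected graphs, each with at least two vertices, let $u_i\in V_i$ and $v_1,\dots,v_k\in V_H$ (not necessarily distinct), and let $J=G_{1,\ldots,k}\circ^{u_1,\dots,u_k}_{v_1,\dots,v_k}H$. Let $i\ne j$, $u'_i\in V_i\setminus\{u_i\}$ and $u'_j\in V_j\setminus\{u_j\}$. Then $u'_i$ and $u'_j$ are mutually maximally distant in $J$ if and only if $u'_i$ is maximally distant from $u_i$ in $G_i$ and $u'_j$ is maximally distant from $u_j$ in $G_j$.
   Context: All graphs are finite, undirected and simple. In a connected graph $G$, $d_G(x,y)$ is the distance and $N_G(x)$ the set of neighbours of $x$. A vertex $u$ is maximally distant from a vertex $w$ in $G$ if there is no $v\in N_G(u)$ with $d_G(v,w)>d_G(u,w)$; two vertices are mutually maximally distant if each is maximally distant from the other. The composed graph $J=G_{1,\ldots,k}\circ^{u_1,\dots,u_k}_{v_1,\dots,v_k}H$ has vertex set $(V_1\cup\dots\cup V_k\cup V_H)\setminus\{u_1,\dots,u_k\}$ and edge set $(E_1\cup\dots\cup E_k\cup E_H\cup\{\{x,v_i\}: x\in N_{G_i}(u_i),1\le i\le k\})\setminus\{\{x,u_i\}: x\in N_{G_i}(u_i),1\le i\le k\}$; i.e. $J$ is obtained by identifying each $u_i$ with $v_i$. -}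

module Defs where

open import Data.Nat using (ℕ; zero; suc; _<_; _≤_)
open import Data.Fin using (Fin; _≟_)
open import Data.Bool using (Bool; true; false; T)
open import Data.Product using (Σ; ∃; _×_; _,_)
open import Data.Empty using (⊥)
open import Relation.Nullary using (¬_)
open import Relation.Nullary.Decidable using (False)
open import Relation.Binary.PropositionalEquality using (_≡_)

record SimpleGraph (n : ℕ) : Set where
  field
    adj    : Fin n → Fin n → Bool
    sym    : ∀ x y → adj x y ≡ adj y x
    irrefl : ∀ x → adj x x ≡ false

record Graph : Set₁ where
  field
    V : Set
    E : V → V → Set

open Graph public

toGraph : ∀ {n} → SimpleGraph n → Graph
toGraph {n} G = record { V = Fin n ; E = λ x y → T (SimpleGraph.adj G x y) }

data Walk (G : Graph) : V G → V G → ℕ → Set where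
  here : ∀ x → Walk G x x zero
  step : ∀ {x y z m} → E G x y → Walk G y z m → Walk G x z (suc m)

Connected : Graph → Set
Connected G = ∀ x y → ∃ λ m → Walk G x y m

Dist : (G : Graph) → V G → V G → ℕ → Set
Dist G x y m = Walk G x y m × (∀ m' → Walk G x y m' → m ≤ m')

MaxDistant : (G : Graph) → V G → V G → Set
MaxDistant G u w =
  ¬ (Σ (V G) λ v → Σ ℕ λ a → Σ ℕ λ b →
       E G u v × Dist G v w a × Dist G u w b × b < a)

MutuallyMaxDistant : (G : Graph) → V G → V G → Set
MutuallyMaxDistant G x y = MaxDistant G x y × MaxDistant G y x

module Compose {k : ℕ} {n : Fin k → ℕ} (G : (i : Fin k) → SimpleGraph (n i))
               {nH : ℕ} (H : SimpleGraph nH)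
               (u : (i : Fin k) → Fin (n i)) (v : Fin k → Fin nH) where

  -- vertices: (V_1 ∪ … ∪ V_k ∪ V_H) \ {u_1,…,u_k}, as a disjoint union
  data JV : Set where
    gv : (i : Fin k) (x : Fin (n i)) → False (x ≟ u i) → JV
    hv : Fin nH → JV

  adjG : (i : Fin k) → Fin (n i) → Fin (n i) → Set
  adjG i x y = T (SimpleGraph.adj (G i) x y)

  adjH : Fin nH → Fin nH → Set
  adjH a b = T (SimpleGraph.adj H a b)

  data JE : JV → JV → Set where
    eG  : ∀ i x y px py → adjG i x y → JE (gv i x px) (gv i y py)
    eH  : ∀ a b → adjH a b → JE (hv a) (hv b)
    eGH : ∀ i x px → adjG i x (u i) → JE (gv i x px) (hv (v i))
    eHG : ∀ i x px → adjG i x (u i) → JE (hv (v i)) (gv i x px)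

  J : Graph
  J = record { V = JV ; E = JE }

{-# OPTIONS --safe #-}
module Submission where

-- A copy G_i meets the rest of J only in the cut vertex v_i (which replaces u_i),
-- so for t outside G_i every shortest walk from x ∈ G_i to t passes through v_i,
-- and d_J(x,t) = d_{G_i}(x,u_i) + d_J(v_i,t).  Hence moving x to a neighbour
-- inside G_i changes d_J(x,t) exactly as it changes d_{G_i}(x,u_i), while moving
-- x to v_i only decreases it.  So x is maximally distant from t in J iff it is
-- maximally distant from u_i in G_i; applying this to u'_i and u'_j separately
-- gives the theorem.

open import Defs
open import Data.Nat using (ℕ; zero; suc; _+_; _≤_; _<_; z≤n; s≤s; _≤?_)
open import Data.Nat.Properties
  using (≤-trans; ≤-antisym; ≰⇒>; <⇒≱; m≤n+m; +-mono-≤; +-monoˡ-<; +-cancelʳ-<)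
open import Data.Nat.Induction using (<-rec)
open import Data.Fin using (Fin; _≟_)
open import Data.Product using (Σ; ∃; _×_; _,_; proj₁; proj₂)
open import Data.Product.Function.NonDependent.Propositional using (_×-⇔_)
open import Data.Unit using (⊤)
open import Data.Empty using (⊥; ⊥-elim)
open import Data.Bool using (T)
open import Relation.Nullary using (¬_; yes; no)
open import Relation.Nullary.Decidable using (False; toWitnessFalse; fromWitnessFalse)
open import Relation.Binary.PropositionalEquality
  using (_≡_; _≢_; refl; sym; subst; subst₂; cong)
open import Function.Bundles using (_⇔_; mk⇔)

module _ {g : Graph} where

  _++_ : ∀ {x y z a b} → Walk g x y a → Walk g y z b → Walk g x z (a + b)
  here _   ++ w′ = w′
  step e w ++ w′ = step e (w ++ w′)

  _∷ʳ_ : ∀ {x y z a} → Walk g x y a → E g y z → Walk g x z (suc a)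
  here _    ∷ʳ e = step e (here _)
  step e′ w ∷ʳ e = step e′ (w ∷ʳ e)

  Dist-unique : ∀ {x y a b} → Dist g x y a → Dist g x y b → a ≡ b
  Dist-unique (wa , mina) (wb , minb) = ≤-antisym (mina _ wb) (minb _ wa)

-- Without a decision procedure for walks, an inhabited predicate on ℕ has a
-- least element only up to double negation; that suffices, as MaxDistant is a
-- negation.
¬¬-least : (P : ℕ → Set) → ∀ {m} → P m → ¬ ¬ (∃ λ a → P a × (∀ b → P b → a ≤ b))
¬¬-least P {m} pm noLeast = <-rec (λ m → ¬ P m) ¬P m pm
  where
  ¬P : ∀ m → (∀ {b} → b < m → ¬ P b) → ¬ P m
  ¬P m ¬P< pm = noLeast (m , pm , least)
    where
    least : ∀ b → P b → m ≤ b
    least b pb with m ≤? b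
    ... | yes m≤b = m≤b
    ... | no  m≰b = ⊥-elim (¬P< (≰⇒> m≰b) pb)

walk⇒¬¬Dist : ∀ {g : Graph} {x y m} → Walk g x y m → ¬ ¬ (∃ (Dist g x y))
walk⇒¬¬Dist {g} {x} {y} w = ¬¬-least (Walk g x y) w

module Cut {k : ℕ} {n : Fin k → ℕ} (G : (i : Fin k) → SimpleGraph (n i))
           {nH : ℕ} (H : SimpleGraph nH)
           (u : (i : Fin k) → Fin (n i)) (v : Fin k → Fin nH) where
  open Compose G H u v

  Outside : Fin k → JV → Set
  Outside i (gv j _ _) = i ≢ j
  Outside i (hv _)     = ⊤

  JE-sym : ∀ {a b} → JE a b → JE b a
  JE-sym (eG i x y px py e) = eG i y x py px (subst T (SimpleGraph.sym (G i) x y) e)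
  JE-sym (eH a b e)         = eH b a (subst T (SimpleGraph.sym H a b) e)
  JE-sym (eGH i x px e)     = eHG i x px e
  JE-sym (eHG i x px e)     = eGH i x px e

  reverse : ∀ {a b m} → Walk J a b m → Walk J b a m
  reverse (here _)   = here _
  reverse (step e w) = reverse w ∷ʳ JE-sym e

  embedH : ∀ {a b m} → Walk (toGraph H) a b m → Walk J (hv a) (hv b) m
  embedH (here _)   = here _
  embedH (step e w) = step (eH _ _ e) (embedH w)

  split-at-cut : ∀ {i x px t m} → Outside i t → Walk J (gv i x px) t m →
                 Σ ℕ λ p → Σ ℕ λ q →
                   Walk (toGraph (G i)) x (u i) p × Walk J (hv (v i)) t q × p + q ≡ m
  split-at-cut out (here _) = ⊥-elim (out refl)
  split-at-cut out (step (eG _ _ _ _ _ e) w) with split-at-cut out w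
  ... | p , q , wG , wJ , p+q≡m = suc p , q , step e wG , wJ , cong suc p+q≡m
  split-at-cut out (step (eGH _ _ _ e) w) = 1 , _ , step e (here _) , w , refl

  -- The walk in G_i is followed up to its first visit of u_i, which is where
  -- it crosses over to v_i; hence only an upper bound on the length.
  join-at-cut : ∀ {i x p t q} (px : False (x ≟ u i)) →
                Walk (toGraph (G i)) x (u i) p → Walk J (hv (v i)) t q →
                Σ ℕ λ m → m ≤ p + q × Walk J (gv i x px) t m
  join-at-cut px (here _) _ = ⊥-elim (toWitnessFalse px refl)
  join-at-cut {i} {x} {suc p} {q = q} px (step {y = y} e wG) wJ with y ≟ u i
  ... | yes refl = suc q , s≤s (m≤n+m q p) , step (eGH i x px e) wJ
  ... | no  y≢u  with join-at-cut (fromWitnessFalse y≢u) wG wJ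
  ...   | m , m≤p+q , w = suc m , s≤s m≤p+q , step (eG i x y px _ e) w

  Dist-through-cut : ∀ {i x p t r} (px : False (x ≟ u i)) → Outside i t →
                     Dist (toGraph (G i)) x (u i) p → Dist J (hv (v i)) t r →
                     Dist J (gv i x px) t (p + r)
  Dist-through-cut {i} {x} {p} {t} {r} px out (wG , minG) (wJ , minJ) =
    subst (Walk J (gv i x px) t) m≡p+r w , lower
    where
    lower : ∀ m → Walk J (gv i x px) t m → p + r ≤ m
    lower m w′ with split-at-cut out w′
    ... | p′ , q′ , wG′ , wJ′ , p′+q′≡m =
      subst (p + r ≤_) p′+q′≡m (+-mono-≤ (minG _ wG′) (minJ _ wJ′))
    joined = join-at-cut px wG wJ
    w = proj₂ (proj₂ joined)
    m≡p+r : proj₁ joined ≡ p + r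
    m≡p+r = ≤-antisym (proj₁ (proj₂ joined)) (lower _ w)

  module _ {i : Fin k} {x : Fin (n i)} (px : False (x ≟ u i)) {t : JV} (out : Outside i t) where

    MaxDistant-to-cut : ∀ {m} → Walk J (hv (v i)) t m →
                        MaxDistant J (gv i x px) t → MaxDistant (toGraph (G i)) x (u i)
    MaxDistant-to-cut _ _ (z , a , b , _ , (_ , minz) , _ , b<a) with z ≟ u i
    MaxDistant-to-cut _ _ (z , a , b , _ , (_ , minz) , _ , b<a) | yes refl =
      <⇒≱ b<a (≤-trans (minz 0 (here _)) z≤n)
    MaxDistant-to-cut wt maxJ (z , a , b , e , dz , dx , b<a) | no z≢u =
      walk⇒¬¬Dist wt λ { (r , dr) →
        maxJ ( gv i z (fromWitnessFalse z≢u) , a + r , b + r , eG i x z px _ e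
             , Dist-through-cut _ out dz dr , Dist-through-cut px out dx dr
             , +-monoˡ-< r b<a ) }

    MaxDistant-from-cut : MaxDistant (toGraph (G i)) x (u i) → MaxDistant J (gv i x px) t
    MaxDistant-from-cut maxG (.(gv i z pz) , a , b , eG _ _ z _ pz e , dz , dx , b<a)
      with split-at-cut out (proj₁ dz) | split-at-cut out (proj₁ dx)
    ... | _ , _ , wz , _ , _ | _ , _ , wx , wt , _ =
      walk⇒¬¬Dist wz λ { (p , dzG) →
      walk⇒¬¬Dist wx λ { (q , dxG) →
      walk⇒¬¬Dist wt λ { (r , dr) →
        let a≡p+r = Dist-unique dz (Dist-through-cut pz out dzG dr)
            b≡q+r = Dist-unique dx (Dist-through-cut px out dxG dr)
        in maxG (z , p , q , e , dzG , dxG ,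
                 +-cancelʳ-< r q p (subst₂ _<_ b≡q+r a≡p+r b<a)) } } }
    MaxDistant-from-cut _ (.(hv (v i)) , a , b , eGH _ _ _ _ , (_ , minv) , (wx , _) , b<a)
      with split-at-cut out wx
    ... | p , q , _ , wt , p+q≡b =
      <⇒≱ b<a (≤-trans (minv q wt) (subst (q ≤_) p+q≡b (m≤n+m q p)))

    MaxDistant-cut⇔ : ∀ {m} → Walk J (hv (v i)) t m →
                      MaxDistant J (gv i x px) t ⇔ MaxDistant (toGraph (G i)) x (u i)
    MaxDistant-cut⇔ wt = mk⇔ (MaxDistant-to-cut wt) MaxDistant-from-cut

  walk-to-copy : (∀ j → Connected (toGraph (G j))) → Connected (toGraph H) →
                 ∀ a j y (py : False (y ≟ u j)) → ∃ (Walk J (hv a) (gv j y py))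
  walk-to-copy connG connH a j y py =
    let toVj = embedH (proj₂ (connH a (v j)))
        fromY = proj₂ (proj₂ (join-at-cut py (proj₂ (connG j y (u j))) (here (hv (v j)))))
    in _ , toVj ++ reverse fromY

lemma5 : (k : ℕ) → 1 ≤ k →
         (n : Fin k → ℕ) (G : (i : Fin k) → SimpleGraph (n i)) →
         (nH : ℕ) (H : SimpleGraph nH) →
         (∀ i → 2 ≤ n i) → 2 ≤ nH →
         (∀ i → Connected (toGraph (G i))) → Connected (toGraph H) →
         (u : (i : Fin k) → Fin (n i)) (v : Fin k → Fin nH) →
         (i j : Fin k) → i ≢ j →
         (x : Fin (n i)) (px : False (x ≟ u i)) →
         (y : Fin (n j)) (py : False (y ≟ u j)) →
         MutuallyMaxDistant (Compose.J G H u v) (Compose.gv i x px) (Compose.gv j y py)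
           ⇔ (MaxDistant (toGraph (G i)) x (u i) × MaxDistant (toGraph (G j)) y (u j))
lemma5 k _ n G nH H _ _ connG connH u v i j i≢j x px y py =
  MaxDistant-cut⇔ px i≢j (proj₂ (walk-to-copy connG connH (v i) j y py))
    ×-⇔ MaxDistant-cut⇔ py (λ j≡i → i≢j (sym j≡i)) (proj₂ (walk-to-copy connG connH (v j) i x px))
  where open Cut G H u v
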